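{- Let $M$ be a first order model. Then the least general model over it is $(M, \mathcal L)$, where $\mathcal L$ is the set of all teams $\|\phi(\bar x, \bar m)\|_M=\{s:\mathrm{Dom}(s)=\bar x, M\models_s\phi(\bar x,\bar m)\}$, where $\phi$ ranges over all first order formulas and $\bar m$ ranges over all tuples of elements of $M$ of suitable length.
   Context: A general model $(M,\mathcal G)$ is a structure $M$ with a set $\mathcal G$ of teams. Teams are sets of assignments with a common finite domain. It is required that for every first-order $\phi(x_1\ldots x_n,\bar m,\bar R)$ with element parameters $\bar m$ and relation parameters $R_i=\mathrm{Rel}(X_i)=\{s(\bar z):s\in X_i\}$, $X_i\in\mathcal G$, the team $\|\phi\|_M=\{s:\mathrm{Dom}(s)=\{x_1\ldots x_n\},M\models_s\phi\}$ is in $\mathcal G$. The least general model over $M$ is $(M,\mathcal L)$ with $\mathcal L$ the intersection of all such $\mathcal G$. This intersection is itself a general model. -}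

module Defs where

open import Level using (Level; suc)
open import Data.Nat using (ℕ; _+_; _<_)
open import Data.Fin using (Fin)
open import Data.List using (List; length)
open import Data.List.Relation.Unary.Linked using (Linked)
open import Data.Vec using (Vec; []; _∷_; lookup; _++_)
open import Data.Product using (Σ; Σ-syntax; ∃; ∃-syntax; _×_; _,_; proj₁)
open import Data.Sum using (_⊎_)
open import Data.Empty using (⊥)
open import Data.Unit using (⊤)
open import Relation.Binary.PropositionalEquality using (_≡_)
open import Function.Bundles using (_⇔_)

record Signature : Set₁ where
  field
    FunSym   : Set
    funArity : FunSym → ℕ
    RelSym   : Set
    relArity : RelSym → ℕ
open Signature public

record Structure (σ : Signature) : Set₁ where
  field
    Carrier : Set
    funI    : (f : FunSym σ) → Vec Carrier (funArity σ f) → Carrier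
    relI    : (r : RelSym σ) → Vec Carrier (relArity σ r) → Set
open Structure public

-- A term / formula indexed by n has its free
-- variables among the n variables  Fin n  (de Bruijn style: a binder
-- adds a new variable 0).  Formulas may additionally use k relation
-- parameters R₀ … R_{k-1} of arities  ar i .

module Syntax (σ : Signature) where

  data Term (n : ℕ) : Set where
    var : Fin n → Term n
    app : (f : FunSym σ) → Vec (Term n) (funArity σ f) → Term n

  data Formula (k : ℕ) (ar : Fin k → ℕ) (n : ℕ) : Set where
    _≐_  : Term n → Term n → Formula k ar n
    rel  : (r : RelSym σ) → Vec (Term n) (relArity σ r) → Formula k ar n
    par  : (i : Fin k) → Vec (Term n) (ar i) → Formula k ar n
    ⊤'   : Formula k ar n
    ⊥'   : Formula k ar n
    ¬'_  : Formula k ar n → Formula k ar n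
    _∧'_ : Formula k ar n → Formula k ar n → Formula k ar n
    _∨'_ : Formula k ar n → Formula k ar n → Formula k ar n
    _⇒'_ : Formula k ar n → Formula k ar n → Formula k ar n
    ∃'   : Formula k ar (Data.Nat.suc n) → Formula k ar n
    ∀'   : Formula k ar (Data.Nat.suc n) → Formula k ar n

open Syntax public

noPar : Fin 0 → ℕ
noPar ()

module Semantics {σ : Signature} (M : Structure σ) where

  A : Set
  A = Carrier M

  mutual
    eval : ∀ {n} → Vec A n → Term σ n → A
    eval ρ (var x)    = lookup ρ x
    eval ρ (app f ts) = funI M f (evalVec ρ ts)

    evalVec : ∀ {n m} → Vec A n → Vec (Term σ n) m → Vec A m
    evalVec ρ []       = []
    evalVec ρ (t ∷ ts) = eval ρ t ∷ evalVec ρ ts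

  Sat : ∀ {k ar n} → ((i : Fin k) → Vec A (ar i) → Set) →
        Formula σ k ar n → Vec A n → Set
  Sat R (t ≐ u)    ρ = eval ρ t ≡ eval ρ u
  Sat R (rel r ts) ρ = relI M r (evalVec ρ ts)
  Sat R (par i ts) ρ = R i (evalVec ρ ts)
  Sat R ⊤'         ρ = ⊤
  Sat R ⊥'         ρ = ⊥
  Sat R (¬' φ)     ρ = Sat R φ ρ → ⊥
  Sat R (φ ∧' ψ)   ρ = Sat R φ ρ × Sat R ψ ρ
  Sat R (φ ∨' ψ)   ρ = Sat R φ ρ ⊎ Sat R ψ ρ
  Sat R (φ ⇒' ψ)   ρ = Sat R φ ρ → Sat R ψ ρ
  Sat R (∃' φ)     ρ = Σ A (λ a → Sat R φ (a ∷ ρ))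
  Sat R (∀' φ)     ρ = (a : A) → Sat R φ (a ∷ ρ)

  -- A domain is a finite set of variables (variables = ℕ),
  -- represented canonically as a strictly increasing list.  An
  -- assignment with domain D is the vector of its values listed in
  -- increasing order of the variables; a team with domain D is a set
  -- (predicate) of such assignments.

  Domain : Set
  Domain = Σ (List ℕ) (Linked _<_)

  size : Domain → ℕ
  size D = length (proj₁ D)

  Assignment : Domain → Set
  Assignment D = Vec A (size D)

  Team : Domain → Set₁
  Team D = Assignment D → Set

  TeamEq : (D : Domain) → Team D → Team D → Set
  TeamEq D X Y = (s : Assignment D) → (X s ⇔ Y s)

  -- Rel(X) = { s(z̄) : s ∈ X }, z̄ the domain variables in increasing order
  Rel : (D : Domain) → Team D → Vec A (size D) → Set
  Rel D X = X

  -- ‖φ(x̄, m̄, R̄)‖_M with x̄ = the variables of D (φ's first size D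
  -- free variables), m̄ the element parameters (the next p variables).
  ‖_‖ : ∀ {k ar p} (D : Domain) →
        Formula σ k ar (size D + p) → Vec A p →
        ((i : Fin k) → Vec A (ar i) → Set) → Team D
  ‖_‖ D φ m R s = Sat R φ (s ++ m)

  -- General models.  A family of teams is a predicate on teams
  -- (indexed by domain).  Since teams are sets, such a family must
  -- respect equality of teams (extensionality).

  TeamFamily : Set₂
  TeamFamily = (D : Domain) → Team D → Set₁

  IsGeneral : TeamFamily → Set₁
  IsGeneral 𝒢 =
    (∀ (D : Domain) (X Y : Team D) → TeamEq D X Y → 𝒢 D X → 𝒢 D Y)
    ×
    (∀ (k : ℕ) (Ds : Fin k → Domain) (Xs : (i : Fin k) → Team (Ds i)) →
       (∀ i → 𝒢 (Ds i) (Xs i)) →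
       ∀ (p : ℕ) (D : Domain) (φ : Formula σ k (λ i → size (Ds i)) (size D + p))
         (m : Vec A p) →
       𝒢 D (‖ D ‖ φ m (λ i → Rel (Ds i) (Xs i))))

  LeastGeneral : (D : Domain) → Team D → Set₂
  LeastGeneral D X = ∀ (𝒢 : TeamFamily) → IsGeneral 𝒢 → 𝒢 D X

  noRel : (i : Fin 0) → Vec A (noPar i) → Set
  noRel ()

  Definable : (D : Domain) → Team D → Set
  Definable D X =
    Σ[ p ∈ ℕ ] Σ[ φ ∈ Formula σ 0 noPar (size D + p) ] Σ[ m ∈ Vec A p ]
      (TeamEq D X (‖ D ‖ φ m noRel))

open Semantics public

-- (⇐) A definable team is an instance of the closure condition of any general
--     model with no relation parameters, so it lies in their intersection.
-- (⇒) It suffices that the definable teams themselves form a general model.  For closure under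
--     formulas, let φ(x̄, m̄, R̄) use R_i = Rel(X_i) with X_i = ‖ψ_i(z̄, m̄_i)‖:
--     replacing every atom R_i(t̄) by ψ_i(t̄, m̄_i) gives a parameter-free
--     formula defining the same team, with element parameters m̄ m̄_0 … m̄_{k-1}.

module Submission where

open import Defs
open import Level using (Lift; lift; lower)
open import Data.Nat using (ℕ; zero; suc; _+_)
open import Data.Fin using (Fin; zero; suc; splitAt; _↑ˡ_; _↑ʳ_)
open import Data.Vec using (Vec; []; _∷_; lookup; _++_)
open import Data.Vec.Properties using (lookup-++ˡ; lookup-++ʳ; lookup-splitAt)
open import Data.Product using (Σ; _×_; _,_; proj₁; proj₂)
open import Data.Sum using (inj₁; inj₂; [_,_]′)
open import Data.Product.Function.NonDependent.Propositional using (_×-⇔_)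
open import Data.Product.Function.Dependent.Propositional using (Σ-⇔)
open import Data.Sum.Function.Propositional using (_⊎-⇔_)
open import Function.Related.TypeIsomorphisms using (→-cong-⇔; ¬-cong-⇔)
open import Function.Construct.Identity using (⇔-id; ↠-id)
import Function.Properties.Equivalence as ⇔
open import Function.Bundles using (_⇔_; mk⇔; Equivalence)
open import Relation.Binary.PropositionalEquality using (_≡_; refl; sym; trans; cong; cong₂)

≡⇒⇔ : {P Q : Set} → P ≡ Q → P ⇔ Q
≡⇒⇔ refl = ⇔-id _

Π-⇔ : {B : Set} {P Q : B → Set} → (∀ b → P b ⇔ Q b) → ((b : B) → P b) ⇔ ((b : B) → Q b)
Π-⇔ P⇔Q = mk⇔ (λ f b → Equivalence.to (P⇔Q b) (f b)) (λ g b → Equivalence.from (P⇔Q b) (g b))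

Σ-⇔′ : {B : Set} {P Q : B → Set} → (∀ b → P b ⇔ Q b) → Σ B P ⇔ Σ B Q
Σ-⇔′ P⇔Q = Σ-⇔ (↠-id _) (λ {b} → P⇔Q b)

module _ {σ : Signature} where

  mutual
    substTerm : ∀ {n n'} → (Fin n → Term σ n') → Term σ n → Term σ n'
    substTerm τ (var x)    = τ x
    substTerm τ (app f ts) = app f (substTerms τ ts)

    substTerms : ∀ {n n' m} → (Fin n → Term σ n') → Vec (Term σ n) m → Vec (Term σ n') m
    substTerms τ []       = []
    substTerms τ (t ∷ ts) = substTerm τ t ∷ substTerms τ ts

  liftSubst : ∀ {n n'} → (Fin n → Term σ n') → Fin (suc n) → Term σ (suc n')
  liftSubst τ zero    = var zero
  liftSubst τ (suc j) = substTerm (λ x → var (suc x)) (τ j)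

  subst : ∀ {k ar n n'} → (Fin n → Term σ n') → Formula σ k ar n → Formula σ k ar n'
  subst τ (t ≐ u)    = substTerm τ t ≐ substTerm τ u
  subst τ (rel r ts) = rel r (substTerms τ ts)
  subst τ (par i ts) = par i (substTerms τ ts)
  subst τ ⊤'         = ⊤'
  subst τ ⊥'         = ⊥'
  subst τ (¬' φ)     = ¬' subst τ φ
  subst τ (φ ∧' ψ)   = subst τ φ ∧' subst τ ψ
  subst τ (φ ∨' ψ)   = subst τ φ ∨' subst τ ψ
  subst τ (φ ⇒' ψ)   = subst τ φ ⇒' subst τ ψ
  subst τ (∃' φ)     = ∃' (subst (liftSubst τ) φ)
  subst τ (∀' φ)     = ∀' (subst (liftSubst τ) φ)

  -- The substitution instantiating a formula ψ(z̄, ȳ) at  z̄ := t̄  and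
  -- ȳ := the context variables π.
  instantiate : ∀ {a p n} → Vec (Term σ n) a → (Fin p → Fin n) → Fin (a + p) → Term σ n
  instantiate {a} ts π j = [ lookup ts , (λ y → var (π y)) ]′ (splitAt a j)

  substPar : ∀ {k ar k' ar' n} {p : Fin k → ℕ} →
             ((i : Fin k) → Fin (p i) → Fin n) →
             ((i : Fin k) → Formula σ k' ar' (ar i + p i)) →
             Formula σ k ar n → Formula σ k' ar' n
  substPar π ψ (t ≐ u)    = t ≐ u
  substPar π ψ (rel r ts) = rel r ts
  substPar π ψ (par i ts)    = subst (instantiate ts (π i)) (ψ i)
  substPar π ψ ⊤'         = ⊤'
  substPar π ψ ⊥'         = ⊥'
  substPar π ψ (¬' φ)     = ¬' substPar π ψ φ
  substPar π ψ (φ ∧' χ)   = substPar π ψ φ ∧' substPar π ψ χ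
  substPar π ψ (φ ∨' χ)   = substPar π ψ φ ∨' substPar π ψ χ
  substPar π ψ (φ ⇒' χ)   = substPar π ψ φ ⇒' substPar π ψ χ
  substPar π ψ (∃' φ)     = ∃' (substPar (λ i y → suc (π i y)) ψ φ)
  substPar π ψ (∀' φ)     = ∀' (substPar (λ i y → suc (π i y)) ψ φ)

totalLength : (k : ℕ) → (Fin k → ℕ) → ℕ
totalLength zero    p = 0
totalLength (suc k) p = p zero + totalLength k (λ i → p (suc i))

concatFamily : {B : Set} (k : ℕ) (p : Fin k → ℕ) →
               ((i : Fin k) → Vec B (p i)) → Vec B (totalLength k p)
concatFamily zero    p vs = []
concatFamily (suc k) p vs = vs zero ++ concatFamily k (λ i → p (suc i)) (λ i → vs (suc i))

position : (k : ℕ) (p : Fin k → ℕ) (i : Fin k) → Fin (p i) → Fin (totalLength k p)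
position (suc k) p zero    y = y ↑ˡ _
position (suc k) p (suc i) y = p zero ↑ʳ position k (λ i → p (suc i)) i y

lookup-concatFamily : {B : Set} (k : ℕ) (p : Fin k → ℕ) (vs : (i : Fin k) → Vec B (p i)) →
                      ∀ i y →
                      lookup (concatFamily k p vs) (position k p i y) ≡ lookup (vs i) y
lookup-concatFamily (suc k) p vs zero    y = lookup-++ˡ (vs zero) _ y
lookup-concatFamily (suc k) p vs (suc i) y =
  trans (lookup-++ʳ (vs zero) _ _) (lookup-concatFamily k _ (λ i → vs (suc i)) i y)

embedLeft : (d : ℕ) {p : ℕ} (q : ℕ) → Fin (d + p) → Fin (d + (p + q))
embedLeft zero    q j       = j ↑ˡ q
embedLeft (suc d) q zero    = zero
embedLeft (suc d) q (suc j) = suc (embedLeft d q j)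

lookup-embedLeft : {B : Set} {d p q : ℕ} (u : Vec B d) (v : Vec B p) (w : Vec B q) →
                   ∀ j →
                   lookup (u ++ (v ++ w)) (embedLeft d q j) ≡ lookup (u ++ v) j
lookup-embedLeft []      v w j       = lookup-++ˡ v w j
lookup-embedLeft (x ∷ u) v w zero    = refl
lookup-embedLeft (x ∷ u) v w (suc j) = lookup-embedLeft u v w j

module _ {σ : Signature} (M : Structure σ) where

  Realises : ∀ {n n'} → (Fin n → Term σ n') → Vec (A M) n → Vec (A M) n' → Set
  Realises τ ρ ρ' = ∀ j → eval M ρ' (τ j) ≡ lookup ρ j

  mutual
    eval-subst : ∀ {n n'} {τ : Fin n → Term σ n'} {ρ ρ'} →
                 Realises τ ρ ρ' → ∀ t → eval M ρ' (substTerm τ t) ≡ eval M ρ t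
    eval-subst τ-ok (var x)    = τ-ok x
    eval-subst τ-ok (app f ts) = cong (funI M f) (evalVec-subst τ-ok ts)

    evalVec-subst : ∀ {n n' m} {τ : Fin n → Term σ n'} {ρ ρ'} →
                    Realises τ ρ ρ' → (ts : Vec (Term σ n) m) →
                    evalVec M ρ' (substTerms τ ts) ≡ evalVec M ρ ts
    evalVec-subst τ-ok []       = refl
    evalVec-subst τ-ok (t ∷ ts) = cong₂ _∷_ (eval-subst τ-ok t) (evalVec-subst τ-ok ts)

  eval-weaken : ∀ {n} (ρ : Vec (A M) n) a t →
                eval M (a ∷ ρ) (substTerm (λ x → var (suc x)) t) ≡ eval M ρ t
  eval-weaken ρ a = eval-subst {ρ = ρ} {ρ' = a ∷ ρ} (λ _ → refl)

  realises-lift : ∀ {n n'} {τ : Fin n → Term σ n'} {ρ ρ'} →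
                  Realises τ ρ ρ' → ∀ a → Realises (liftSubst τ) (a ∷ ρ) (a ∷ ρ')
  realises-lift τ-ok a zero    = refl
  realises-lift {τ = τ} {ρ' = ρ'} τ-ok a (suc j) = trans (eval-weaken ρ' a (τ j)) (τ-ok j)

  sat-subst : ∀ {k ar n n'} (R : (i : Fin k) → Vec (A M) (ar i) → Set)
              {τ : Fin n → Term σ n'} {ρ ρ'} → Realises τ ρ ρ' →
              (φ : Formula σ k ar n) → Sat M R (subst τ φ) ρ' ⇔ Sat M R φ ρ
  sat-subst R τ-ok (t ≐ u)    = ≡⇒⇔ (cong₂ _≡_ (eval-subst τ-ok t) (eval-subst τ-ok u))
  sat-subst R τ-ok (rel r ts) = ≡⇒⇔ (cong (relI M r) (evalVec-subst τ-ok ts))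
  sat-subst R τ-ok (par i ts) = ≡⇒⇔ (cong (R i) (evalVec-subst τ-ok ts))
  sat-subst R τ-ok ⊤'         = ⇔-id _
  sat-subst R τ-ok ⊥'         = ⇔-id _
  sat-subst R τ-ok (¬' φ)     = ¬-cong-⇔ (sat-subst R τ-ok φ)
  sat-subst R τ-ok (φ ∧' ψ)   = sat-subst R τ-ok φ ×-⇔ sat-subst R τ-ok ψ
  sat-subst R τ-ok (φ ∨' ψ)   = sat-subst R τ-ok φ ⊎-⇔ sat-subst R τ-ok ψ
  sat-subst R τ-ok (φ ⇒' ψ)   = →-cong-⇔ (sat-subst R τ-ok φ) (sat-subst R τ-ok ψ)
  sat-subst R τ-ok (∃' φ)     = Σ-⇔′ (λ a → sat-subst R (realises-lift τ-ok a) φ)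
  sat-subst R τ-ok (∀' φ)     = Π-⇔ (λ a → sat-subst R (realises-lift τ-ok a) φ)

  lookup-evalVec : ∀ {n m} (ρ : Vec (A M) n) (ts : Vec (Term σ n) m) j →
                   eval M ρ (lookup ts j) ≡ lookup (evalVec M ρ ts) j
  lookup-evalVec ρ (t ∷ ts) zero    = refl
  lookup-evalVec ρ (t ∷ ts) (suc j) = lookup-evalVec ρ ts j

  realises-instantiate : ∀ {a p n} (ρ : Vec (A M) n) (ts : Vec (Term σ n) a)
                         {π : Fin p → Fin n} {ms : Vec (A M) p} →
                         (∀ y → lookup ρ (π y) ≡ lookup ms y) →
                         Realises (instantiate ts π) (evalVec M ρ ts ++ ms) ρ
  realises-instantiate {a} ρ ts {π} {ms} π-ok j =
    trans (by-side (splitAt a j)) (sym (lookup-splitAt a (evalVec M ρ ts) ms j))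
    where
    by-side : ∀ e → eval M ρ ([ lookup ts , (λ y → var (π y)) ]′ e)
                      ≡ [ lookup (evalVec M ρ ts) , lookup ms ]′ e
    by-side (inj₁ x) = lookup-evalVec ρ ts x
    by-side (inj₂ y) = π-ok y

  sat-substPar : ∀ {k ar k' ar' n} {p : Fin k → ℕ}
                 (R : (i : Fin k) → Vec (A M) (ar i) → Set)
                 (R' : (i : Fin k') → Vec (A M) (ar' i) → Set)
                 {π : (i : Fin k) → Fin (p i) → Fin n}
                 {ψ : (i : Fin k) → Formula σ k' ar' (ar i + p i)}
                 {ms : (i : Fin k) → Vec (A M) (p i)} {ρ : Vec (A M) n} →
                 (∀ i y → lookup ρ (π i y) ≡ lookup (ms i) y) →
                 (∀ i v → Sat M R' (ψ i) (v ++ ms i) ⇔ R i v) →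
                 (φ : Formula σ k ar n) → Sat M R' (substPar π ψ φ) ρ ⇔ Sat M R φ ρ
  sat-substPar R R' π-ok ψ-ok (t ≐ u)    = ⇔-id _
  sat-substPar R R' π-ok ψ-ok (rel r ts) = ⇔-id _
  sat-substPar R R' {ψ = ψ} {ρ = ρ} π-ok ψ-ok (par i ts) =
    ⇔.trans (sat-subst R' (realises-instantiate ρ ts (π-ok i)) (ψ i)) (ψ-ok i (evalVec M ρ ts))
  sat-substPar R R' π-ok ψ-ok ⊤'         = ⇔-id _
  sat-substPar R R' π-ok ψ-ok ⊥'         = ⇔-id _
  sat-substPar R R' π-ok ψ-ok (¬' φ)     = ¬-cong-⇔ (sat-substPar R R' π-ok ψ-ok φ)
  sat-substPar R R' π-ok ψ-ok (φ ∧' χ)   = sat-substPar R R' π-ok ψ-ok φ ×-⇔ sat-substPar R R' π-ok ψ-ok χ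
  sat-substPar R R' π-ok ψ-ok (φ ∨' χ)   = sat-substPar R R' π-ok ψ-ok φ ⊎-⇔ sat-substPar R R' π-ok ψ-ok χ
  sat-substPar R R' π-ok ψ-ok (φ ⇒' χ)   =
    →-cong-⇔ (sat-substPar R R' π-ok ψ-ok φ) (sat-substPar R R' π-ok ψ-ok χ)
  sat-substPar R R' π-ok ψ-ok (∃' φ)     = Σ-⇔′ (λ a → sat-substPar R R' π-ok ψ-ok φ)
  sat-substPar R R' π-ok ψ-ok (∀' φ)     = Π-⇔ (λ a → sat-substPar R R' π-ok ψ-ok φ)

  definable-closed : ∀ k (Ds : Fin k → Domain M) (Xs : (i : Fin k) → Team M (Ds i)) →
                     (∀ i → Definable M (Ds i) (Xs i)) →
                     ∀ p D (φ : Formula σ k (λ i → size M (Ds i)) (size M D + p)) m →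
                     Definable M D (‖_‖ M D φ m (λ i → Rel M (Ds i) (Xs i)))
  definable-closed k Ds Xs defs p D φ m = p + q , φ' , m ++ allParams , defines
    where
    d : ℕ
    d = size M D
    P : Fin k → ℕ
    P i = proj₁ (defs i)
    ψ : (i : Fin k) → Formula σ 0 noPar (size M (Ds i) + P i)
    ψ i = proj₁ (proj₂ (defs i))
    ms : (i : Fin k) → Vec (A M) (P i)
    ms i = proj₁ (proj₂ (proj₂ (defs i)))
    q : ℕ
    q = totalLength k P
    allParams : Vec (A M) q
    allParams = concatFamily k P ms

    weaken : Fin (d + p) → Term σ (d + (p + q))
    weaken j = var (embedLeft d q j)
    π : (i : Fin k) → Fin (P i) → Fin (d + (p + q))
    π i y = d ↑ʳ (p ↑ʳ position k P i y)
    φ' : Formula σ 0 noPar (d + (p + q))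
    φ' = substPar π ψ (subst weaken φ)

    defines : ∀ s → Sat M (λ i → Rel M (Ds i) (Xs i)) φ (s ++ m)
                      ⇔ Sat M (noRel M) φ' (s ++ (m ++ allParams))
    defines s = ⇔.sym (⇔.trans (sat-substPar _ (noRel M) π-ok ψ-ok (subst weaken φ))
                                (sat-subst _ weaken-ok φ))
      where
      weaken-ok : Realises weaken (s ++ m) (s ++ (m ++ allParams))
      weaken-ok = lookup-embedLeft s m allParams
      π-ok : ∀ i y → lookup (s ++ (m ++ allParams)) (π i y) ≡ lookup (ms i) y
      π-ok i y = trans (lookup-++ʳ s _ _) (trans (lookup-++ʳ m _ _) (lookup-concatFamily k P ms i y))
      ψ-ok : ∀ i v → Sat M (noRel M) (ψ i) (v ++ ms i) ⇔ Rel M (Ds i) (Xs i) v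
      ψ-ok i v = ⇔.sym (proj₂ (proj₂ (proj₂ (defs i))) v)

  DefinableFamily : TeamFamily M
  DefinableFamily D X = Lift _ (Definable M D X)

  definable-general : IsGeneral M DefinableFamily
  definable-general =
    respects-eq ,
    λ k Ds Xs defs p D φ m → lift (definable-closed k Ds Xs (λ i → lower (defs i)) p D φ m)
    where
    respects-eq : ∀ D X Y → TeamEq M D X Y → DefinableFamily D X → DefinableFamily D Y
    respects-eq D X Y X≈Y (lift (p , φ , m , X≈φ)) =
      lift (p , φ , m , λ s → ⇔.trans (⇔.sym (X≈Y s)) (X≈φ s))

  -- Every definable team lies in every general model: a parameter-free φ,
  -- read as a formula over the empty list of relation parameters, is an
  -- instance of the closure condition.
  definable-least : ∀ D X → Definable M D X → LeastGeneral M D X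
  definable-least D X (p , φ , m , X≈φ) 𝒢 (respects-eq , closed) =
    respects-eq D _ X (λ s → ⇔.sym (⇔.trans (X≈φ s) (⇔.sym (reading-ok s))))
      (closed 0 noDomain noTeam (λ ()) p D φ₀ m)
    where
    noDomain : Fin 0 → Domain M
    noDomain ()
    noTeam : (i : Fin 0) → Team M (noDomain i)
    noTeam ()
    φ₀ : Formula σ 0 (λ i → size M (noDomain i)) (size M D + p)
    φ₀ = substPar {p = λ ()} (λ ()) (λ ()) φ
    reading-ok : ∀ s → Sat M (λ i → Rel M (noDomain i) (noTeam i)) φ₀ (s ++ m)
                         ⇔ Sat M (noRel M) φ (s ++ m)
    reading-ok s = sat-substPar (noRel M) _ {ms = λ ()} (λ ()) (λ ()) φ

mainTheorem13 : ∀ (σ : Signature) (M : Structure σ) (D : Domain M) (X : Team M D) →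
                  (LeastGeneral M D X → Definable M D X) × (Definable M D X → LeastGeneral M D X)
mainTheorem13 σ M D X = least⇒definable , definable-least M D X
  where
  least⇒definable : LeastGeneral M D X → Definable M D X
  least⇒definable inAll = lower (inAll (DefinableFamily M) (definable-general M))
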